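{- Let $G$ be a finite simple graph with at least two vertices and let $u\in V(G)$ be a simplicial vertex of $G$. Then $\gamma_{gr}(G-u)\ge \gamma_{gr}(G)-1$.
   Context: A vertex $u$ is simplicial if its open neighborhood $N(u)$ induces a complete graph. For a vertex $v$, $N[v]$ denotes its closed neighborhood. A sequence $S=(v_1,\ldots,v_k)$ of distinct vertices of $G$ is a legal sequence if $N[v_i]\setminus\bigcup_{j=1}^{i-1}N[v_j]\neq\emptyset$ for every $i$; it is a dominating sequence if moreover $\{v_1,\ldots,v_k\}$ dominates $G$. The Grundy domination number $\gamma_{gr}(G)$ is the maximum length of a legal dominating sequence of $G$. $G-u$ is $G$ with the vertex $u$ deleted. -}

module Defs where

open import Data.Nat using (ℕ; suc; _≤_)
open import Data.Fin using (Fin; punchIn)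
open import Data.Bool using (Bool; true; false)
open import Data.List using (List; []; _∷_; _++_; [_]; length)
open import Data.List.Relation.Unary.All using (All)
open import Data.List.Relation.Unary.Any using (Any)
open import Data.List.Relation.Unary.Unique.Propositional using (Unique)
open import Data.Product using (Σ; ∃; _×_)
open import Data.Sum using (_⊎_)
open import Data.Unit using (⊤)
open import Relation.Nullary using (¬_)
open import Relation.Binary.PropositionalEquality using (_≡_; _≢_)

record Graph (n : ℕ) : Set where
  field
    adj    : Fin n → Fin n → Bool
    irrefl : ∀ v → adj v v ≡ false
    sym    : ∀ v w → adj v w ≡ adj w v
open Graph public

Adj : ∀ {n} → Graph n → Fin n → Fin n → Set
Adj G v w = adj G v w ≡ true

InClosedNbhd : ∀ {n} → Graph n → Fin n → Fin n → Set
InClosedNbhd G v w = (w ≡ v) ⊎ Adj G v w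

Simplicial : ∀ {n} → Graph n → Fin n → Set
Simplicial G u = ∀ x y → Adj G u x → Adj G u y → x ≢ y → Adj G x y

deleteVertex : ∀ {n} → Graph (suc n) → Fin (suc n) → Graph n
deleteVertex G u = record
  { adj    = λ i j → adj G (punchIn u i) (punchIn u j)
  ; irrefl = λ i → irrefl G (punchIn u i)
  ; sym    = λ i j → sym G (punchIn u i) (punchIn u j)
  }

-- LegalFrom G prev S : each vertex of S, in order, has a vertex in its closed
-- neighbourhood not in the closed neighbourhood of any earlier vertex
-- (earlier = those in prev, followed by those earlier in S).
LegalFrom : ∀ {n} → Graph n → List (Fin n) → List (Fin n) → Set
LegalFrom G prev [] = ⊤
LegalFrom G prev (v ∷ vs) =
  (∃ λ w → InClosedNbhd G v w × All (λ x → ¬ InClosedNbhd G x w) prev)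
  × LegalFrom G (prev ++ [ v ]) vs

Legal : ∀ {n} → Graph n → List (Fin n) → Set
Legal G S = Unique S × LegalFrom G [] S

Dominates : ∀ {n} → Graph n → List (Fin n) → Set
Dominates G S = ∀ w → Any (λ v → InClosedNbhd G v w) S

LegalDominating : ∀ {n} → Graph n → List (Fin n) → Set
LegalDominating G S = Legal G S × Dominates G S

IsGrundyDominationNumber : ∀ {n} → Graph n → ℕ → Set
IsGrundyDominationNumber G k =
  (∃ λ S → LegalDominating G S × length S ≡ k)
  × (∀ S → LegalDominating G S → length S ≤ k)

-- Take a longest legal dominating sequence S of G and drop from it the first
-- vertex whose closed neighbourhood contains u. Every other vertex of S and the
-- vertex it footprints differ from u: before u is dominated this is immediate,
-- and afterwards a footprint w ∈ N(u) of u itself would be adjacent, by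
-- simpliciality, to the earlier vertex dominating u. So the remaining vertices
-- form a legal sequence of G - u, which extends greedily to a legal dominating
-- one.
module Submission where

open import Defs
open import Data.Nat using (ℕ; suc; _+_; _≤_; z≤n; s≤s)
open import Data.Nat.Properties using (≤-refl; ≤-trans; +-comm; m≤m+n)
open import Data.Fin using (Fin; punchIn; punchOut; _≟_)
open import Data.Fin.Properties using (punchIn-injective; punchIn-punchOut)
import Data.Bool as Bool
open import Data.List using (List; []; _∷_; _++_; [_]; length; allFin)
open import Data.List.Properties using (length-++; ++-assoc; ++-identityʳ)
open import Data.List.Relation.Unary.All as All using (All; []; _∷_)
open import Data.List.Relation.Unary.All.Properties using (¬Any⇒All¬) renaming (++⁺ to All-++⁺)
open import Data.List.Relation.Unary.Any as Any using (Any; here; any?)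
open import Data.List.Relation.Unary.Any.Properties using (++⁺ˡ; ++⁺ʳ)
open import Data.List.Relation.Unary.AllPairs using ([]; _∷_)
open import Data.List.Relation.Unary.Unique.Propositional using (Unique)
open import Data.List.Membership.Propositional using (_∈_)
open import Data.List.Membership.Propositional.Properties using (∈-allFin)
open import Data.Product using (∃; _×_; _,_; proj₁; proj₂)
open import Data.Sum using (inj₁; inj₂)
open import Data.Unit using (tt)
open import Data.Empty using (⊥)
open import Relation.Nullary using (¬_; Dec; yes; no)
open import Relation.Nullary.Decidable using (_⊎-dec_)
open import Relation.Binary.PropositionalEquality
  using (_≡_; _≢_; refl; cong; subst; subst₂; trans) renaming (sym to ≡-sym)

module _ {n : ℕ} (G : Graph n) where

  Footprint : List (Fin n) → Fin n → Fin n → Set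
  Footprint prev v w = InClosedNbhd G v w × All (λ x → ¬ InClosedNbhd G x w) prev

  Dominated : List (Fin n) → Fin n → Set
  Dominated T w = Any (λ v → InClosedNbhd G v w) T

  inClosedNbhd? : ∀ v w → Dec (InClosedNbhd G v w)
  inClosedNbhd? v w = (w ≟ v) ⊎-dec (adj G v w Bool.≟ Bool.true)

  legalFrom-∷ʳ : ∀ prev T {v} → LegalFrom G prev T → ∃ (Footprint (prev ++ T) v)
               → LegalFrom G prev (T ++ [ v ])
  legalFrom-∷ʳ prev []       _         fp =
    subst (λ l → ∃ (Footprint l _)) (++-identityʳ prev) fp , tt
  legalFrom-∷ʳ prev (t ∷ ts) (ft , lg) fp =
    ft , legalFrom-∷ʳ (prev ++ [ t ]) ts lg (subst (λ l → ∃ (Footprint l _)) (≡-sym (++-assoc prev [ t ] ts)) fp)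

  -- A repeated vertex would footprint a vertex of its own closed neighbourhood.
  legalFrom-avoids : ∀ prev S {x} → LegalFrom G prev S → x ∈ prev → All (x ≢_) S
  legalFrom-avoids prev []       _                     _   = []
  legalFrom-avoids prev (s ∷ ss) ((_ , fw , nd) , lg) x∈ =
    (λ { refl → All.lookup nd x∈ fw }) ∷ legalFrom-avoids (prev ++ [ s ]) ss lg (++⁺ˡ x∈)

  legalFrom⇒unique : ∀ prev S → LegalFrom G prev S → Unique S
  legalFrom⇒unique prev []       _        = []
  legalFrom⇒unique prev (s ∷ ss) (_ , lg) =
    legalFrom-avoids (prev ++ [ s ]) ss lg (++⁺ʳ prev (here refl)) ∷ legalFrom⇒unique (prev ++ [ s ]) ss lg

  -- Greedily append each listed vertex that is not yet dominated; it footprints itself.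
  dominate-greedily : ∀ T → LegalFrom G [] T → (ws : List (Fin n))
    → ∃ λ T′ → LegalFrom G [] T′ × length T ≤ length T′
             × (∀ {w} → Dominated T w → Dominated T′ w) × All (Dominated T′) ws
  dominate-greedily T lg [] = T , lg , ≤-refl , (λ d → d) , []
  dominate-greedily T lg (w ∷ ws) with any? (λ v → inClosedNbhd? v w) T
  ... | yes d =
    let (T′ , lg′ , len , mono , doms) = dominate-greedily T lg ws
    in T′ , lg′ , len , mono , mono d ∷ doms
  ... | no ¬d =
    let lgw = legalFrom-∷ʳ [] T lg (w , inj₁ refl , ¬Any⇒All¬ T ¬d)
        (T′ , lg′ , len , mono , doms) = dominate-greedily (T ++ [ w ]) lgw ws
        grows = subst (length T ≤_) (≡-sym (length-++ T)) (m≤m+n (length T) 1)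
    in T′ , lg′ , ≤-trans grows len , (λ d → mono (++⁺ˡ d)) , mono (++⁺ʳ T (here (inj₁ refl))) ∷ doms

  legal⇒length≤grundy : ∀ {b T} → IsGrundyDominationNumber G b → LegalFrom G [] T → length T ≤ b
  legal⇒length≤grundy {T = T} (_ , maximal) lg =
    let (T′ , lg′ , len , _ , doms) = dominate-greedily T lg (allFin n)
        dominating = (legalFrom⇒unique [] T′ lg′ , lg′) , (λ w → All.lookup doms (∈-allFin w))
    in ≤-trans len (maximal T′ dominating)

module _ {n : ℕ} (G : Graph (suc n)) (u : Fin (suc n)) where

  private
    H = deleteVertex G u

  closedNbhd-punchIn⁺ : ∀ {x w} → InClosedNbhd H x w → InClosedNbhd G (punchIn u x) (punchIn u w)
  closedNbhd-punchIn⁺ (inj₁ w≡x) = inj₁ (cong (punchIn u) w≡x)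
  closedNbhd-punchIn⁺ (inj₂ xw)  = inj₂ xw

  closedNbhd-punchIn⁻ : ∀ {x w} → InClosedNbhd G (punchIn u x) (punchIn u w) → InClosedNbhd H x w
  closedNbhd-punchIn⁻ {x} {w} (inj₁ e) = inj₁ (punchIn-injective u w x e)
  closedNbhd-punchIn⁻         (inj₂ xw) = inj₂ xw

  Lifts : List (Fin (suc n)) → List (Fin n) → Set
  Lifts prev prevH = All (λ x → punchIn u x ∈ prev) prevH

  lifts-∷ʳ : ∀ {prev prevH s} (u≢s : u ≢ s) → Lifts prev prevH
           → Lifts (prev ++ [ s ]) (prevH ++ [ punchOut u≢s ])
  lifts-∷ʳ {prev} u≢s lifts =
    All-++⁺ (All.map ++⁺ˡ lifts) (++⁺ʳ prev (here (punchIn-punchOut u≢s)) ∷ [])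

  footprint-punchOut : ∀ {prev prevH s w} (u≢s : u ≢ s) (u≢w : u ≢ w) → Lifts prev prevH
    → Footprint G prev s w → Footprint H prevH (punchOut u≢s) (punchOut u≢w)
  footprint-punchOut {prev} u≢s u≢w lifts fp =
    let (sw , nd) = subst₂ (Footprint G prev) (≡-sym (punchIn-punchOut u≢s)) (≡-sym (punchIn-punchOut u≢w)) fp
    in closedNbhd-punchIn⁻ sw , All.map (λ x∈ xw → All.lookup nd x∈ (closedNbhd-punchIn⁺ xw)) lifts

  module _ (simplicial : Simplicial G u) where

    footprint-avoids-dominated : ∀ {prev s w} → Dominated G prev u
      → Footprint G prev s w → u ≢ s × u ≢ w
    footprint-avoids-dominated {prev} {s} {w} d (sw , nd) = u≢s , u≢w
      where
      x = Any.lookup d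
      x∌w×x∋u = All.lookupAny nd d
      x∌w = proj₁ x∌w×x∋u
      x∋u = proj₂ x∌w×x∋u
      u≢w : u ≢ w
      u≢w refl = x∌w x∋u
      u≢s : u ≢ s
      u≢s refl = u-footprints-nothing sw x∋u
        where
        u-footprints-nothing : InClosedNbhd G u w → InClosedNbhd G x u → ⊥
        u-footprints-nothing (inj₁ w≡u) _          = u≢w (≡-sym w≡u)
        u-footprints-nothing (inj₂ uw)  (inj₁ u≡x) = x∌w (subst (λ y → InClosedNbhd G y w) u≡x (inj₂ uw))
        u-footprints-nothing (inj₂ uw)  (inj₂ xu)  =
          x∌w (inj₂ (simplicial x w (trans (Graph.sym G u x) xu) uw (λ x≡w → x∌w (inj₁ (≡-sym x≡w)))))

    legalFrom-delete-dominated : ∀ {prev prevH} S → Dominated G prev u → Lifts prev prevH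
      → LegalFrom G prev S → ∃ λ T → LegalFrom H prevH T × length S ≤ length T
    legalFrom-delete-dominated []       _ _     _             = [] , tt , z≤n
    legalFrom-delete-dominated (s ∷ ss) d lifts ((w , fp) , lg) =
      let (u≢s , u≢w) = footprint-avoids-dominated d fp
          (T , lgT , len) = legalFrom-delete-dominated ss (++⁺ˡ d) (lifts-∷ʳ u≢s lifts) lg
      in punchOut u≢s ∷ T , ((punchOut u≢w , footprint-punchOut u≢s u≢w lifts fp) , lgT) , s≤s len

    legalFrom-delete : ∀ {prev prevH} S → Lifts prev prevH
      → LegalFrom G prev S → ∃ λ T → LegalFrom H prevH T × length S ≤ suc (length T)
    legalFrom-delete []                _     _             = [] , tt , z≤n
    legalFrom-delete {prev} (s ∷ ss) lifts ((w , fp) , lg) with inClosedNbhd? G s u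
    ... | yes s∋u =
      let (T , lgT , len) = legalFrom-delete-dominated ss (++⁺ʳ prev (here s∋u)) (All.map ++⁺ˡ lifts) lg
      in T , lgT , s≤s len
    ... | no s∌u =
      let u≢s = λ u≡s → s∌u (inj₁ u≡s)
          u≢w = λ u≡w → s∌u (subst (InClosedNbhd G s) (≡-sym u≡w) (proj₁ fp))
          (T , lgT , len) = legalFrom-delete ss (lifts-∷ʳ u≢s lifts) lg
      in punchOut u≢s ∷ T , ((punchOut u≢w , footprint-punchOut u≢s u≢w lifts fp) , lgT) , s≤s len

proposition2p4 : (n : ℕ) (G : Graph (suc (suc n))) (u : Fin (suc (suc n)))
    → Simplicial G u
    → (a b : ℕ)
    → IsGrundyDominationNumber G a
    → IsGrundyDominationNumber (deleteVertex G u) b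
    → a ≤ b + 1
proposition2p4 n G u simplicial a b ((S , ((_ , legalS) , _) , refl) , _) grundyG-u =
  let (T , legalT , |S|≤1+|T|) = legalFrom-delete G u simplicial S [] legalS
  in ≤-trans |S|≤1+|T| (subst (suc (length T) ≤_) (+-comm 1 b) (s≤s (legal⇒length≤grundy _ grundyG-u legalT)))
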